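{- Let $\mathcal C=\{e_1,\dots,e_m\}$ be a chain of length $m$. Then (i) $\mathcal C$ is induced $K_5^-$-free; (ii) for every $i\in[m-1]$, $|e_i\cap e_{i+1}|=2$, and $|e_i\cap e_j|=0$ for all $i,j$ with $|i-j|>1$.
   Context: A chain of length $m$ is the $5$-uniform hypergraph on an ordered set of distinct vertices $w_1,\dots,w_{3m+2}$ with edges $e_i=\{w_{3i-2},w_{3i-1},w_{3i},w_{3i+1},w_{3i+2}\}$ for $i\in[m]$. The $2$-skeleton of a hypergraph $\mathcal H$ is the graph on $V(\mathcal H)$ with $ab$ an edge iff $\{a,b\}$ is contained in some edge of $\mathcal H$. $K_5^-$ is $K_5$ minus one edge. A hypergraph is induced $K_5^-$-free if the vertex set of every copy of $K_5^-$ in its $2$-skeleton is contained in an edge of the hypergraph. -}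

module Defs where

open import Data.Nat using (ℕ; zero; suc; _+_; _*_; _≤ᵇ_)
open import Data.Bool using (Bool; _∧_)
open import Data.Fin using (Fin; toℕ)
open import Data.Fin.Subset using (Subset; _∈_)
open import Data.Vec using (tabulate)
open import Data.Product using (Σ; _×_; ∃)
open import Relation.Binary.PropositionalEquality using (_≡_; _≢_)
open import Function.Definitions using (Injective)
open import Relation.Nullary using (¬_)

record Hypergraph (n : ℕ) : Set where
  field
    nEdges : ℕ
    edge   : Fin nEdges → Subset n
open Hypergraph public

Skel : ∀ {n} → Hypergraph n → Fin n → Fin n → Set
Skel H a b = (a ≢ b) × ∃ λ k → (a ∈ edge H k) × (b ∈ edge H k)

-- Edges of K5^- on vertex set Fin 5: all pairs {i,j}, i ≠ j, except {0,1}.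
K5⁻Edge : Fin 5 → Fin 5 → Set
K5⁻Edge i j = (i ≢ j) × ¬ (toℕ i + toℕ j ≡ 1)

IsK5⁻Copy : ∀ {n} → (Fin n → Fin n → Set) → (Fin 5 → Fin n) → Set
IsK5⁻Copy G f = Injective _≡_ _≡_ f × (∀ i j → K5⁻Edge i j → G (f i) (f j))

InducedK5⁻Free : ∀ {n} → Hypergraph n → Set
InducedK5⁻Free H =
  ∀ (f : Fin 5 → Fin _) → IsK5⁻Copy (Skel H) f →
    ∃ λ k → ∀ i → f i ∈ edge H k

-- Chain of length m on vertices w_1..w_{3m+2}, realised as Fin (3m+2)
-- (0-based: w_{t+1} ↦ t).  Edge with 0-based index i (i.e. e_{i+1}) is
-- {3i, 3i+1, 3i+2, 3i+3, 3i+4}, which is e_{i+1} = {w_{3i+1},...,w_{3i+5}}.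
chainEdge : (m : ℕ) → Fin m → Subset (3 * m + 2)
chainEdge m i = tabulate λ v → (3 * toℕ i ≤ᵇ toℕ v) ∧ (toℕ v ≤ᵇ 3 * toℕ i + 4)

chain : (m : ℕ) → Hypergraph (3 * m + 2)
chain m = record { nEdges = m ; edge = chainEdge m }

-- Edge e_{k+1} of the chain is the interval [3k, 3k+4] of vertex indices, so everything is about
-- intervals. For i ≤ j the edges e_{i+1}, e_{j+1} meet in [3j, 3i+4], which has two points when
-- j = i+1 and none when j ≥ i+2. For a copy x₀,…,x₄ of K5⁻ with x₀x₁ missing, both {x₀,x₂,x₃,x₄}
-- and {x₁,x₂,x₃,x₄} are cliques of the 2-skeleton, hence by the Helly property of intervals each
-- lies in an edge; these edges share the three points x₂,x₃,x₄, while distinct edges share at most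
-- two, so they coincide and contain all five vertices.

module Submission where

open import Defs
open import Data.Nat using (ℕ; suc; _<_; ∣_-_∣)
open import Data.Fin using (Fin; toℕ)
open import Data.Fin.Subset using (_∩_; ∣_∣)
open import Data.Product using (_×_)
open import Relation.Binary.PropositionalEquality using (_≡_)

open import Data.Bool using (Bool; true; false; _∧_; T)
open import Data.Bool.Properties using (T-≡; T-∧; ∧-zeroʳ)
open import Data.Empty using (⊥-elim)
open import Data.Fin using (zero; suc; punchIn; fromℕ<)
open import Data.Fin.Properties
  using (toℕ<n; toℕ-injective; suc-injective; punchIn-injective; punchInᵢ≢i; fromℕ<-injective; injective⇒≤)
  renaming (_≟_ to _≟ᶠ_)
open import Data.Fin.Subset using (_∈_)
open import Data.Fin.Subset.Properties using (∩-comm)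
open import Data.List using (List; allFin)
open import Data.List.Extrema.Nat using (argmin; argmax; f[argmin]≤f[xs]; f[xs]≤f[argmax])
open import Data.List.Membership.Propositional.Properties using (∈-allFin)
import Data.List.Relation.Unary.All as All
open import Data.Nat using (zero; _+_; _*_; _∸_; _≤_; _≤ᵇ_; z≤n; s≤s; pred)
open import Data.Nat.Properties
  using ( ≤-trans; ≤-reflexive; ≤⇒≤ᵇ; ≤ᵇ⇒≤; <-cmp; n≮n; n≤1+n; m≤m+n; m≤n+m; +-comm; *-suc
        ; +-monoˡ-≤; *-monoʳ-≤; ∸-monoˡ-<; ∸-cancelʳ-≡; 0∸n≡0; m+n∸m≡n; m+n∸n≡m; m≤n⇒m∸n≡0
        ; module ≤-Reasoning)
open import Data.Nat.Tactic.RingSolver using (solve-∀)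
open import Data.Product using (∃; _,_; proj₁; proj₂; map)
open import Data.Sum using (_⊎_; inj₁; inj₂)
open import Data.Vec using (tabulate; _∷_)
open import Data.Vec.Properties using (tabulate-cong; lookup∘tabulate; []=⇒lookup; lookup⇒[]=)
open import Function using (_∘_; Injective; Equivalence)
open import Relation.Binary.Definitions using (tri<; tri≈; tri>)
open import Relation.Binary.PropositionalEquality
  using (_≢_; refl; sym; trans; cong; cong₂; subst; module ≡-Reasoning)
open import Relation.Nullary using (¬_; yes; no)

T-injective : ∀ {x y} → (T x → T y) → (T y → T x) → x ≡ y
T-injective {false} {false} _ _ = refl
T-injective {false} {true}  _ g = ⊥-elim (g _)
T-injective {true}  {false} f _ = ⊥-elim (f _)
T-injective {true}  {true}  _ _ = refl

∈-tabulate⁺ : ∀ {n} {f : Fin n → Bool} {x} → T (f x) → x ∈ tabulate f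
∈-tabulate⁺ {f = f} {x} t = lookup⇒[]= x _ (trans (lookup∘tabulate f x) (Equivalence.to T-≡ t))

∈-tabulate⁻ : ∀ {n} {f : Fin n → Bool} {x} → x ∈ tabulate f → T (f x)
∈-tabulate⁻ {f = f} {x} x∈ = Equivalence.from T-≡ (trans (sym (lookup∘tabulate f x)) ([]=⇒lookup x∈))

tabulate-∩ : ∀ {n} (f g : Fin n → Bool) → tabulate f ∩ tabulate g ≡ tabulate (λ i → f i ∧ g i)
tabulate-∩ {zero}  f g = refl
tabulate-∩ {suc n} f g = cong (f zero ∧ g zero ∷_) (tabulate-∩ (f ∘ suc) (g ∘ suc))

∣tabulate-false∣ : ∀ {n} {f : Fin n → Bool} → (∀ i → f i ≡ false) → ∣ tabulate f ∣ ≡ 0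
∣tabulate-false∣ {zero}          _       = refl
∣tabulate-false∣ {suc n} {f} f≡false rewrite f≡false zero = ∣tabulate-false∣ (f≡false ∘ suc)

_∈[_,_] : ℕ → ℕ → ℕ → Set
v ∈[ a , b ] = a ≤ v × v ≤ b

interval : ℕ → ℕ → ℕ → Bool
interval a b v = (a ≤ᵇ v) ∧ (v ≤ᵇ b)

interval⁺ : ∀ {a b v} → v ∈[ a , b ] → T (interval a b v)
interval⁺ (a≤v , v≤b) = Equivalence.from T-∧ (≤⇒≤ᵇ a≤v , ≤⇒≤ᵇ v≤b)

interval⁻ : ∀ {a b v} → T (interval a b v) → v ∈[ a , b ]
interval⁻ {a} {b} {v} = map (≤ᵇ⇒≤ a v) (≤ᵇ⇒≤ v b) ∘ Equivalence.to T-∧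

interval-∩ : ∀ {a b c d} → a ≤ c → b ≤ d → ∀ v → interval a b v ∧ interval c d v ≡ interval c b v
interval-∩ {a} {b} {c} {d} a≤c b≤d v = T-injective shrink widen
  where
  shrink : T (interval a b v ∧ interval c d v) → T (interval c b v)
  shrink t with Equivalence.to T-∧ t
  ... | inAB , inCD = interval⁺ (proj₁ (interval⁻ {c} {d} inCD) , proj₂ (interval⁻ {a} {b} inAB))
  widen : T (interval c b v) → T (interval a b v ∧ interval c d v)
  widen t with interval⁻ {c} {b} t
  ... | c≤v , v≤b =
    Equivalence.from T-∧ ( interval⁺ {a} {b} (≤-trans a≤c c≤v , v≤b)
                         , interval⁺ {c} {d} (c≤v , ≤-trans v≤b b≤d))

suc-≤ᵇ-suc : ∀ m n → (suc m ≤ᵇ suc n) ≡ (m ≤ᵇ n)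
suc-≤ᵇ-suc zero    n = refl
suc-≤ᵇ-suc (suc m) n = refl

interval-suc : ∀ a b v → interval a (suc b) (suc v) ≡ interval (pred a) b v
interval-suc zero    b v = suc-≤ᵇ-suc v b
interval-suc (suc a) b v = cong₂ _∧_ (suc-≤ᵇ-suc a v) (suc-≤ᵇ-suc v b)

∣tabulate-interval∣ : ∀ {n} a b → b < n → ∣ tabulate {n = n} (λ v → interval a b (toℕ v)) ∣ ≡ suc b ∸ a
∣tabulate-interval∣ {suc n} zero    zero    _         = cong suc (∣tabulate-false∣ {n} (λ _ → refl))
∣tabulate-interval∣ {suc n} (suc a) zero    _         =
  trans (∣tabulate-false∣ {n} (λ _ → ∧-zeroʳ _)) (sym (0∸n≡0 a))
∣tabulate-interval∣ {suc n} zero    (suc b) (s≤s b<n) =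
  cong suc (trans (cong ∣_∣ (tabulate-cong {n = n} (interval-suc zero b ∘ toℕ)))
                  (∣tabulate-interval∣ zero b b<n))
∣tabulate-interval∣ {suc n} (suc a) (suc b) (s≤s b<n) =
  trans (cong ∣_∣ (tabulate-cong {n = n} (interval-suc (suc a) b ∘ toℕ))) (∣tabulate-interval∣ a b b<n)

InChainEdge : ℕ → ℕ → Set
InChainEdge k v = v ∈[ 3 * k , 3 * k + 4 ]

∈-chainEdge⁺ : ∀ {m} {k : Fin m} {x} → InChainEdge (toℕ k) (toℕ x) → x ∈ chainEdge m k
∈-chainEdge⁺ = ∈-tabulate⁺ ∘ interval⁺

∈-chainEdge⁻ : ∀ {m} {k : Fin m} {x} → x ∈ chainEdge m k → InChainEdge (toℕ k) (toℕ x)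
∈-chainEdge⁻ = interval⁻ ∘ ∈-tabulate⁻

chainEdge-∩ : ∀ {m} {i j : Fin m} → toℕ i ≤ toℕ j →
              chainEdge m i ∩ chainEdge m j ≡ tabulate (λ v → interval (3 * toℕ j) (3 * toℕ i + 4) (toℕ v))
chainEdge-∩ i≤j = trans (tabulate-∩ _ _) (tabulate-cong (interval-∩ 3i≤3j (+-monoˡ-≤ 4 3i≤3j) ∘ toℕ))
  where 3i≤3j = *-monoʳ-≤ 3 i≤j

chainEdge-last< : ∀ {m} (i : Fin m) → 3 * toℕ i + 4 < 3 * m + 2
chainEdge-last< {m} i = subst (_≤ 3 * m + 2) (shift (toℕ i)) (+-monoˡ-≤ 2 (*-monoʳ-≤ 3 (toℕ<n i)))
  where
  shift : ∀ x → 3 * suc x + 2 ≡ suc (3 * x + 4)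
  shift = solve-∀

∣chainEdge-∩∣ : ∀ {m} {i j : Fin m} → toℕ i ≤ toℕ j →
                ∣ chainEdge m i ∩ chainEdge m j ∣ ≡ suc (3 * toℕ i + 4) ∸ 3 * toℕ j
∣chainEdge-∩∣ {i = i} {j} i≤j =
  trans (cong ∣_∣ (chainEdge-∩ i≤j)) (∣tabulate-interval∣ (3 * toℕ j) (3 * toℕ i + 4) (chainEdge-last< i))

∣chainEdge-∩-next∣ : ∀ {m} (i j : Fin m) → toℕ j ≡ suc (toℕ i) → ∣ chainEdge m i ∩ chainEdge m j ∣ ≡ 2
∣chainEdge-∩-next∣ i j j≡1+i = begin
  ∣ chainEdge _ i ∩ chainEdge _ j ∣    ≡⟨ ∣chainEdge-∩∣ (≤-trans (n≤1+n _) (≤-reflexive (sym j≡1+i))) ⟩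
  suc (3 * toℕ i + 4) ∸ 3 * toℕ j      ≡⟨ cong₂ _∸_ (shift (toℕ i)) (cong (3 *_) j≡1+i) ⟩
  3 * suc (toℕ i) + 2 ∸ 3 * suc (toℕ i) ≡⟨ m+n∸m≡n (3 * suc (toℕ i)) 2 ⟩
  2                                      ∎
  where
  open ≡-Reasoning
  shift : ∀ x → suc (3 * x + 4) ≡ 3 * suc x + 2
  shift = solve-∀

∣chainEdge-∩-far∣ : ∀ {m} {i j : Fin m} → 2 + toℕ i ≤ toℕ j → ∣ chainEdge m i ∩ chainEdge m j ∣ ≡ 0
∣chainEdge-∩-far∣ {i = i} {j} 2+i≤j =
  trans (∣chainEdge-∩∣ (≤-trans (m≤n+m _ 2) 2+i≤j)) (m≤n⇒m∸n≡0 gap)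
  where
  open ≤-Reasoning
  gap : suc (3 * toℕ i + 4) ≤ 3 * toℕ j
  gap = begin
    suc (3 * toℕ i + 4)     ≤⟨ m≤m+n _ 1 ⟩
    suc (3 * toℕ i + 4) + 1 ≡⟨ shift (toℕ i) ⟩
    3 * (2 + toℕ i)         ≤⟨ *-monoʳ-≤ 3 2+i≤j ⟩
    3 * toℕ j               ∎
    where
    shift : ∀ x → suc (3 * x + 4) + 1 ≡ 3 * (2 + x)
    shift = solve-∀

1<∣m-n∣⇒2+m≤n⊎2+n≤m : ∀ m n → 1 < ∣ m - n ∣ → 2 + m ≤ n ⊎ 2 + n ≤ m
1<∣m-n∣⇒2+m≤n⊎2+n≤m zero    n       1<n = inj₁ 1<n
1<∣m-n∣⇒2+m≤n⊎2+n≤m (suc m) zero    1<m = inj₂ 1<m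
1<∣m-n∣⇒2+m≤n⊎2+n≤m (suc m) (suc n) 1<d with 1<∣m-n∣⇒2+m≤n⊎2+n≤m m n 1<d
... | inj₁ 2+m≤n = inj₁ (s≤s 2+m≤n)
... | inj₂ 2+n≤m = inj₂ (s≤s 2+n≤m)

∣chainEdge-∩-distant∣ : ∀ {m} (i j : Fin m) → 1 < ∣ toℕ i - toℕ j ∣ → ∣ chainEdge m i ∩ chainEdge m j ∣ ≡ 0
∣chainEdge-∩-distant∣ {m} i j 1<∣i-j∣ with 1<∣m-n∣⇒2+m≤n⊎2+n≤m (toℕ i) (toℕ j) 1<∣i-j∣
... | inj₁ 2+i≤j = ∣chainEdge-∩-far∣ 2+i≤j
... | inj₂ 2+j≤i = trans (cong ∣_∣ (∩-comm (chainEdge m i) (chainEdge m j))) (∣chainEdge-∩-far∣ 2+j≤i)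

Linked : ℕ → ℕ → ℕ → Set
Linked m u v = ∃ λ (k : Fin m) → InChainEdge (toℕ k) u × InChainEdge (toℕ k) v

Skel-chain⇒Linked : ∀ {m} {x y} → Skel (chain m) x y → Linked m (toℕ x) (toℕ y)
Skel-chain⇒Linked (_ , k , x∈k , y∈k) = k , ∈-chainEdge⁻ {k = k} x∈k , ∈-chainEdge⁻ {k = k} y∈k

-- Helly property of intervals: the edge linking the least and the greatest point contains all of them.
Linked-clique⇒common-edge : ∀ {m n} (g : Fin (suc (suc n)) → ℕ) →
                            (∀ i j → i ≢ j → Linked m (g i) (g j)) →
                            ∃ λ (k : Fin m) → ∀ i → InChainEdge (toℕ k) (g i)
Linked-clique⇒common-edge {m} {n} g linked = between (linked′ lo hi)
  where
  indices : List (Fin (suc (suc n)))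
  indices = allFin (suc (suc n))
  lo hi : Fin (suc (suc n))
  lo = argmin g zero indices
  hi = argmax g zero indices
  linked′ : ∀ i j → Linked m (g i) (g j)
  linked′ i j with i ≟ᶠ j
  ... | no i≢j = linked i j i≢j
  ... | yes refl with linked i (punchIn i zero) (punchInᵢ≢i i zero ∘ sym)
  ...   | k , i∈k , _ = k , i∈k , i∈k
  between : Linked m (g lo) (g hi) → ∃ λ (k : Fin m) → ∀ i → InChainEdge (toℕ k) (g i)
  between (k , (3k≤lo , _) , (_ , hi≤3k+4)) =
    k , λ i → ≤-trans 3k≤lo (All.lookup (f[argmin]≤f[xs] {f = g} zero indices) (∈-allFin i))
            , ≤-trans (All.lookup (f[xs]≤f[argmax] {f = g} zero indices) (∈-allFin i)) hi≤3k+4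

injective-in-window⇒≤ : ∀ {n a w} (g : Fin n → ℕ) → Injective _≡_ _≡_ g →
                        (∀ i → a ≤ g i × g i < w + a) → n ≤ w
injective-in-window⇒≤ {n} {a} {w} g g-injective in-window = injective⇒≤ offset-injective
  where
  offset< : ∀ i → g i ∸ a < w
  offset< i = subst (g i ∸ a <_) (m+n∸n≡m w a) (∸-monoˡ-< (proj₂ (in-window i)) (proj₁ (in-window i)))
  offset : Fin n → Fin w
  offset i = fromℕ< (offset< i)
  offset-injective : Injective _≡_ _≡_ offset
  offset-injective {i} {j} eq = g-injective (∸-cancelʳ-≡ (proj₁ (in-window i)) (proj₁ (in-window j))
                                  (fromℕ<-injective (g i ∸ a) (g j ∸ a) (offset< i) (offset< j) eq))

chainEdge-overlap : ∀ {k k' u} → k < k' → InChainEdge k u → InChainEdge k' u →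
                    3 + 3 * k ≤ u × u < 2 + (3 + 3 * k)
chainEdge-overlap {k} {k'} k<k' (_ , u≤3k+4) (3k'≤u , _) =
  ≤-trans (≤-trans (≤-reflexive (sym (*-suc 3 k))) (*-monoʳ-≤ 3 k<k')) 3k'≤u ,
  s≤s (≤-trans u≤3k+4 (≤-reflexive (+-comm (3 * k) 4)))

three-points-determine-chainEdge : ∀ {k k'} (g : Fin 3 → ℕ) → Injective _≡_ _≡_ g →
  (∀ i → InChainEdge k (g i)) → (∀ i → InChainEdge k' (g i)) → k ≡ k'
three-points-determine-chainEdge {k} {k'} g g-injective in-k in-k' with <-cmp k k'
... | tri< k<k' _ _ =
  ⊥-elim (n≮n 2 (injective-in-window⇒≤ g g-injective λ i → chainEdge-overlap k<k' (in-k i) (in-k' i)))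
... | tri≈ _ k≡k' _ = k≡k'
... | tri> _ _ k'<k =
  ⊥-elim (n≮n 2 (injective-in-window⇒≤ g g-injective λ i → chainEdge-overlap k'<k (in-k' i) (in-k i)))

-- K5⁻Edge encodes the missing edge as {0, 1}; deleting either endpoint leaves a K4.
K5⁻Edge-punchIn : ∀ {p : Fin 5} → toℕ p ≤ 1 → ∀ {a b} → a ≢ b → K5⁻Edge (punchIn p a) (punchIn p b)
K5⁻Edge-punchIn {p} p≤1 {a} {b} a≢b = a≢b ∘ punchIn-injective p a b , avoids-missing-edge p≤1 a b
  where
  avoids-missing-edge : ∀ {p} → toℕ p ≤ 1 → ∀ a b → ¬ (toℕ (punchIn p a) + toℕ (punchIn p b) ≡ 1)
  avoids-missing-edge {zero}           _          zero    _       ()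
  avoids-missing-edge {zero}           _          (suc a) _       ()
  avoids-missing-edge {suc zero}       _          zero    zero    ()
  avoids-missing-edge {suc zero}       _          zero    (suc b) ()
  avoids-missing-edge {suc zero}       _          (suc a) _       ()
  avoids-missing-edge {suc (suc p)}    (s≤s ())   _       _

K5⁻Copy⇒K4-in-chainEdge : ∀ {m} {f : Fin 5 → Fin (3 * m + 2)} → IsK5⁻Copy (Skel (chain m)) f →
  ∀ p → toℕ p ≤ 1 → ∃ λ (k : Fin m) → ∀ a → InChainEdge (toℕ k) (toℕ (f (punchIn p a)))
K5⁻Copy⇒K4-in-chainEdge {f = f} (_ , f-edges) p p≤1 =
  Linked-clique⇒common-edge (toℕ ∘ f ∘ punchIn p)
    (λ a b a≢b → Skel-chain⇒Linked (f-edges _ _ (K5⁻Edge-punchIn p≤1 a≢b)))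

chain-inducedK5⁻Free : ∀ m → InducedK5⁻Free (chain m)
chain-inducedK5⁻Free m f copy@(f-injective , _) =
  glue (K5⁻Copy⇒K4-in-chainEdge copy zero z≤n) (K5⁻Copy⇒K4-in-chainEdge copy (suc zero) (s≤s z≤n))
  where
  K4-in-chainEdge : Fin 5 → Set
  K4-in-chainEdge p = ∃ λ (k : Fin m) → ∀ a → InChainEdge (toℕ k) (toℕ (f (punchIn p a)))
  glue : K4-in-chainEdge zero → K4-in-chainEdge (suc zero) → ∃ λ (k : Fin m) → ∀ i → f i ∈ chainEdge m k
  glue (k₀ , in-k₀) (k₁ , in-k₁) = k₁ , covers
    where
    k₀≡k₁ : toℕ k₀ ≡ toℕ k₁
    k₀≡k₁ = three-points-determine-chainEdge (λ i → toℕ (f (suc (suc i))))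
              (suc-injective ∘ suc-injective ∘ f-injective ∘ toℕ-injective) (in-k₀ ∘ suc) (in-k₁ ∘ suc)
    covers : ∀ i → f i ∈ chainEdge m k₁
    covers zero          = ∈-chainEdge⁺ {k = k₁} (in-k₁ zero)
    covers (suc zero)    =
      ∈-chainEdge⁺ {k = k₁} (subst (λ k → InChainEdge k (toℕ (f (suc zero)))) k₀≡k₁ (in-k₀ zero))
    covers (suc (suc i)) = ∈-chainEdge⁺ {k = k₁} (in-k₁ (suc i))

mainTheorem8 : (m : ℕ) →
    InducedK5⁻Free (chain m)
    × (∀ (i j : Fin m) → toℕ j ≡ suc (toℕ i) → ∣ chainEdge m i ∩ chainEdge m j ∣ ≡ 2)
    × (∀ (i j : Fin m) → 1 < ∣ toℕ i - toℕ j ∣ → ∣ chainEdge m i ∩ chainEdge m j ∣ ≡ 0)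
mainTheorem8 m = chain-inducedK5⁻Free m , ∣chainEdge-∩-next∣ , ∣chainEdge-∩-distant∣
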